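{- Let $U=\{u_1,\dots,u_{3n}\}$ and $\mathcal{S}=\{S_1,\dots,S_p\}$ be a family of $3$-element subsets of $U$, with $n,p\ge1$, and let $m\ge 6n+3p$ be an integer. Let $G$ be the labeled complete bipartite graph with partite sets $V_1,V_2$ and tolerances $t$ on $V_1$ constructed as in the context. If $G$ has a one-sided $t$-perfect clustering $\mathcal{C}$, then for any $i\ne j$ the vertices $x(S_i)$ and $x(S_j)$ lie in different clusters of $\mathcal{C}$.
   Context: Construction: For each $u_i\in U$ there are ground vertices $x_i\in V_1$, $y_i\in V_2$; the edge $x_iy_j$ is $+$ if $i=j$ or $u_i,u_j$ lie in a common set of $\mathcal{S}$, and $-$ otherwise. For each $S_i\in\mathcal{S}$ there are triplet vertices $x(S_i)\in V_1$ and $y_1(S_i),\dots,y_m(S_i)\in V_2$; edges $x(S_i)y_k(S_i)$ are $+$, and edges $x(S_i)y_k(S_\ell)$ with $i\ne\ell$ are $-$. For $u_i\in U$ and $S_j\in\mathcal{S}$, the edges $x_iy_k(S_j)$ (all $k$) and $y_ix(S_j)$ are $+$ if $u_i\in S_j$ and $-$ otherwise. There are dummy vertices $Z=\{z_1,\dots,z_{3n}\}\subseteq V_2$, joined by $+$ edges to all $x_i$ and by $-$ edges to all $x(S_j)$. Tolerances: $t_{x(S_i)}=3$; for $u_i\in U$, with $d(u_i)$ the number of sets of $\mathcal{S}$ containing $u_i$ and $c(u_i)$ the number of $u_j\ne u_i$ lying in a common set of $\mathcal{S}$ with $u_i$, $t_{x_i}=m(d(u_i)-1)+(c(u_i)-2)+(|Z|-3)$.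 A clustering is a partition of $V_1\cup V_2$; an error is a $+$ edge between clusters or a $-$ edge within a cluster; a clustering is one-sided $t$-perfect if every $v\in V_1$ is incident to at most $t_v$ errors. -}

module Defs where

open import Data.Nat as ℕ using (ℕ; _*_)
open import Data.Integer as ℤ using (ℤ; +_)
open import Data.Fin using (Fin; _≟_)
open import Data.Fin.Subset using (Subset; _∈_)
open import Data.Fin.Subset.Properties using (_∈?_)
open import Data.Fin.Properties using (any?)
open import Data.Bool using (Bool; true; false; _∨_; _∧_; not; if_then_else_)
open import Data.List using (List; map; _++_; concatMap; length; filterᵇ; allFin)
open import Data.Product using (_×_; ∃)
open import Data.Sum using (_⊎_; inj₁; inj₂)
open import Relation.Nullary using (Dec)
open import Relation.Nullary.Decidable using (⌊_⌋; _×-dec_)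

-- The ground set U = {u_0, ..., u_{3n-1}} is Fin (3 * n).
-- A family S_0, ..., S_{p-1} of subsets of U (3-element-ness is a hypothesis).
SetFamily : ℕ → ℕ → Set
SetFamily n p = Fin p → Subset (3 * n)

data V₁ (n p : ℕ) : Set where
  x  : Fin (3 * n) → V₁ n p
  xS : Fin p → V₁ n p

data V₂ (n p m : ℕ) : Set where
  y  : Fin (3 * n) → V₂ n p m
  yS : Fin p → Fin m → V₂ n p m
  z  : Fin (3 * n) → V₂ n p m

Common : ∀ {n p} → SetFamily n p → Fin (3 * n) → Fin (3 * n) → Set
Common {n} {p} S i j = ∃ λ (ℓ : Fin p) → _∈_ {n = 3 * n} i (S ℓ) × _∈_ {n = 3 * n} j (S ℓ)

common? : ∀ {n p} (S : SetFamily n p) i j → Dec (Common {n} S i j)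
common? {n} {p} S i j = any? {n = p} (λ ℓ → (_∈?_ {n = 3 * n} i (S ℓ)) ×-dec (_∈?_ {n = 3 * n} j (S ℓ)))

-- Sign of the edge v w of the complete bipartite graph (true = +, false = -).
pos : ∀ {n p m} → SetFamily n p → V₁ n p → V₂ n p m → Bool
pos {n} S (x i)  (y j)    = ⌊ _≟_ {n = 3 * n} i j ⌋ ∨ ⌊ common? {n} S i j ⌋
pos S (x i)  (yS j k) = ⌊ i ∈? S j ⌋
pos S (x i)  (z k)    = true
pos S (xS i) (y j)    = ⌊ j ∈? S i ⌋
pos S (xS i) (yS l k) = ⌊ i ≟ l ⌋
pos S (xS i) (z k)    = false

Vertex : ℕ → ℕ → ℕ → Set
Vertex n p m = V₁ n p ⊎ V₂ n p m

-- A clustering (partition of V1 ∪ V2) is given by a cluster label per vertex;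
-- two vertices are in the same cluster iff their labels coincide.
Clustering : ℕ → ℕ → ℕ → Set
Clustering n p m = Vertex n p m → ℕ

isError : ∀ {n p m} → SetFamily n p → Clustering n p m → V₁ n p → V₂ n p m → Bool
isError S cl v w =
  if pos S v w then not ⌊ cl (inj₁ v) ℕ.≟ cl (inj₂ w) ⌋
               else ⌊ cl (inj₁ v) ℕ.≟ cl (inj₂ w) ⌋

allV₂ : ∀ n p m → List (V₂ n p m)
allV₂ n p m = map y (allFin (3 * n))
           ++ concatMap (λ j → map (yS j) (allFin m)) (allFin p)
           ++ map z (allFin (3 * n))

errors : ∀ {n p m} → SetFamily n p → Clustering n p m → V₁ n p → ℕ
errors {n} {p} {m} S cl v = length (filterᵇ (isError S cl v) (allV₂ n p m))

deg : ∀ {n p} → SetFamily n p → Fin (3 * n) → ℕ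
deg {n} {p} S i = length (filterᵇ (λ j → ⌊ _∈?_ {n = 3 * n} i (S j) ⌋) (allFin p))

cdeg : ∀ {n p} → SetFamily n p → Fin (3 * n) → ℕ
cdeg {n} {p} S i =
  length (filterᵇ (λ j → not ⌊ _≟_ {n = 3 * n} j i ⌋ ∧ ⌊ common? {n = n} S i j ⌋) (allFin (3 * n)))

-- tolerances (integers, as the formula for t_{x_i} may be negative)
tol : ∀ {n p} → ℕ → SetFamily n p → V₁ n p → ℤ
tol m S (xS _) = + 3
tol {n} m S (x i) =
  (+ m) ℤ.* (+ deg {n = n} S i ℤ.- + 1) ℤ.+ (+ cdeg {n = n} S i ℤ.- + 2) ℤ.+ (+ (3 * n) ℤ.- + 3)

OneSidedPerfect : ∀ {n p m} → SetFamily n p → Clustering n p m → Set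
OneSidedPerfect {n} {p} {m} S cl = ∀ (v : V₁ n p) → + errors S cl v ℤ.≤ tol m S v

module Submission where

-- Idea: x(S_i) is joined by + edges to the m vertices y_1(S_i), …, y_m(S_i),
-- while x(S_j) is joined to the same m vertices by − edges.  If x(S_i) and
-- x(S_j) were in one cluster, then every y_k(S_i) would lie either in that
-- cluster (an error at x(S_j)) or outside it (an error at x(S_i)).  Hence the
-- two vertices together would carry at least m errors, whereas their
-- tolerances allow only 3 + 3 = 6; but m ≥ 6n + 3p ≥ 9.

open import Defs
open import Data.Bool using (Bool; true; false; T; _∨_)
open import Data.Bool.Properties using (T?)
open import Data.Fin using (Fin; _≟_)
open import Data.Fin.Subset using (∣_∣)
open import Data.Integer.Properties using (drop‿+≤+)
open import Data.List using (List; []; _∷_; map; length; filter; filterᵇ; allFin)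
open import Data.List.Properties using (length-map; length-tabulate; filter-all)
open import Data.List.Membership.Propositional.Properties using (∈-map⁺; ∈-allFin)
open import Data.List.Relation.Unary.All using (All; universal)
open import Data.List.Relation.Unary.All.Properties using (map⁺)
import Data.List.Relation.Unary.Any as Any
open import Data.List.Relation.Binary.Pointwise using (≡⇒Pointwise-≡)
open import Data.List.Relation.Binary.Sublist.Propositional using (_⊆_)
open import Data.List.Relation.Binary.Sublist.Propositional.Properties
  using (filter⁺; length-mono-≤; ++⁺ˡ; ++⁺ʳ; xs∈xss⇒xs⊆concat[xss])
open import Data.Nat as ℕ using (ℕ; _≤_; _<_; _*_; _+_)
open import Data.Nat.Properties
  using ( module ≤-Reasoning; ≤-refl; ≤-trans; ≤-reflexive; n≤1+n; +-suc
        ; +-mono-≤; +-monoʳ-≤; *-monoʳ-≤; m≤m+n; ≤⇒≯)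
open import Data.Sum using (inj₁; inj₂)
open import Function using (_∘_; id)
open import Relation.Binary.PropositionalEquality using (_≡_; _≢_; refl; sym; trans; cong)
open import Relation.Nullary using (yes; no; contradiction)

count : ∀ {A : Set} → (A → Bool) → List A → ℕ
count P xs = length (filterᵇ P xs)

count-∨ : ∀ {A : Set} (P Q : A → Bool) (xs : List A) →
  count (λ a → P a ∨ Q a) xs ≤ count P xs + count Q xs
count-∨ P Q [] = ≤-refl
count-∨ P Q (a ∷ xs) with P a | Q a | count-∨ P Q xs
... | true  | true  | ih = ℕ.s≤s (≤-trans ih (+-monoʳ-≤ (count P xs) (n≤1+n _)))
... | true  | false | ih = ℕ.s≤s ih
... | false | true  | ih = ≤-trans (ℕ.s≤s ih) (≤-reflexive (sym (+-suc (count P xs) (count Q xs))))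
... | false | false | ih = ih

count-≥-sublist : ∀ {A : Set} (P : A → Bool) {xs ys : List A} →
  xs ⊆ ys → All (T ∘ P) xs → length xs ≤ count P ys
count-≥-sublist P {xs} {ys} xs⊆ys allP = begin
  length xs                   ≡⟨ cong length (sym (filter-all (T? ∘ P) allP)) ⟩
  length (filter (T? ∘ P) xs) ≤⟨ length-mono-≤ (filter⁺ (T? ∘ P) (T? ∘ P) (λ { refl → id }) xs⊆ys) ⟩
  count P ys                  ∎
  where open ≤-Reasoning

module _ (n : ℕ) {p m : ℕ} (S : SetFamily n p) where

  own-triplet-edge : ∀ i (k : Fin m) → pos {n} {p} {m} S (xS i) (yS i k) ≡ true
  own-triplet-edge i k with i ≟ i
  ... | yes _   = refl
  ... | no i≢i = contradiction refl i≢i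

  foreign-triplet-edge : ∀ {i j} (k : Fin m) → j ≢ i → pos {n} {p} {m} S (xS j) (yS i k) ≡ false
  foreign-triplet-edge {i} {j} k j≢i with j ≟ i
  ... | yes j≡i = contradiction j≡i j≢i
  ... | no _    = refl

  module _ (cl : Clustering n p m) where

    -- If v and v′ share a cluster and w is joined to v by a + edge and to v′
    -- by a − edge, then vw or v′w is an error: w is either in that cluster or not.
    opposite-edges-error : ∀ {v v′ : V₁ n p} (w : V₂ n p m) →
      pos S v w ≡ true → pos S v′ w ≡ false → cl (inj₁ v) ≡ cl (inj₁ v′) →
      (isError S cl v w ∨ isError S cl v′ w) ≡ true
    opposite-edges-error {v} {v′} w +vw -v′w same
      rewrite +vw | -v′w | same with cl (inj₁ v′) ℕ.≟ cl (inj₂ w)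
    ... | yes _ = refl
    ... | no  _ = refl

    triplet-errors≤3 : OneSidedPerfect S cl → ∀ i → errors S cl (xS i) ≤ 3
    triplet-errors≤3 perfect i = drop‿+≤+ (perfect (xS i))

triplet-block⊆V₂ : ∀ n p m (i : Fin p) → map (yS i) (allFin m) ⊆ allV₂ n p m
triplet-block⊆V₂ n p m i =
  ++⁺ˡ (map y (allFin (3 * n)))
    (++⁺ʳ (map z (allFin (3 * n)))
      (xs∈xss⇒xs⊆concat[xss] (Any.map ≡⇒Pointwise-≡ (∈-map⁺ block (∈-allFin i)))))
  where
  block : Fin p → List (V₂ n p m)
  block j = map (yS j) (allFin m)

lemma3 : (n p m : ℕ) (S : SetFamily n p) →
    1 ≤ n → 1 ≤ p → 6 * n + 3 * p ≤ m →
    (∀ j → ∣ S j ∣ ≡ 3) →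
    (cl : Clustering n p m) → OneSidedPerfect S cl →
    ∀ (i j : Fin p) → i ≢ j → cl (inj₁ (xS i)) ≢ cl (inj₁ (xS j))
lemma3 n p m S 1≤n 1≤p m-large _ cl perfect i j i≢j same = ≤⇒≯ m≤6 6<m
  where
  errᵢ errⱼ : V₂ n p m → Bool
  errᵢ = isError S cl (xS i)
  errⱼ = isError S cl (xS j)

  block-errors : ∀ k → T (errᵢ (yS i k) ∨ errⱼ (yS i k))
  block-errors k rewrite opposite-edges-error n S cl (yS i k)
    (own-triplet-edge n S i k) (foreign-triplet-edge n S k (i≢j ∘ sym)) same = _

  m≤6 : m ≤ 6
  m≤6 = begin
    m                                  ≡⟨ sym (trans (length-map (yS i) (allFin m)) (length-tabulate id)) ⟩
    length (map (yS i) (allFin m))     ≤⟨ count-≥-sublist _ (triplet-block⊆V₂ n p m i)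
                                            (map⁺ (universal block-errors (allFin m))) ⟩
    count (λ w → errᵢ w ∨ errⱼ w) (allV₂ n p m)
                                       ≤⟨ count-∨ errᵢ errⱼ (allV₂ n p m) ⟩
    errors S cl (xS i) + errors S cl (xS j)
                                       ≤⟨ +-mono-≤ (triplet-errors≤3 n S cl perfect i)
                                                   (triplet-errors≤3 n S cl perfect j) ⟩
    6                                  ∎
    where open ≤-Reasoning

  -- 7 ≤ 9 = 6·1 + 3·1 ≤ 6n + 3p ≤ m
  6<m : 6 < m
  6<m = ≤-trans (m≤m+n 7 2) (≤-trans (+-mono-≤ (*-monoʳ-≤ 6 1≤n) (*-monoʳ-≤ 3 1≤p)) m-large)
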